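{- Let $l\geq 2$, let $a_1,\dots,a_l\geq 3$ and $1\leq k<\min\{a_1,\dots,a_l\}$ be integers, and let $G=K_{a_{1}}\circ_{k}K_{a_{2}}\circ_{k}\cdots\circ_{k}K_{a_{l}}$. Then $\epsilon(G)$ is irreducible.
   Context: All graphs are finite, simple and connected. $d(u,v)$ is the distance and $e(v)=\max_u d(u,v)$ the eccentricity. The eccentricity matrix $\epsilon(G)$ has $(u,v)$ entry $d(u,v)$ if $d(u,v)=\min\{e(u),e(v)\}$ and $0$ otherwise. The $k$-coalescence $K_{a_{1}}\circ_{k}\cdots\circ_{k}K_{a_{l}}$ has vertex set a disjoint union $C\cup P_1\cup\cdots\cup P_l$ with $|C|=k$, $|P_i|=a_i-k$, each $C\cup P_i$ inducing a complete graph, and no edges between $P_i$ and $P_j$ for $i\ne j$. A square matrix is irreducible if it is not permutation-similar to a block upper triangular matrix with two nontrivial diagonal blocks (for a symmetric nonnegative matrix: the graph with edges at its nonzero off-diagonal entries is connected). -}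

module Defs where

open import Data.Nat using (ℕ; zero; suc; _≤_; _<_; _⊔_; _⊓_; _≡ᵇ_)
open import Data.Bool using (Bool; true; false; _∧_; _∨_; not; if_then_else_)
open import Data.Fin using (Fin; toℕ)
open import Data.Fin.Properties using () renaming (_≟_ to _≟F_)
open import Data.Maybe using (Maybe; nothing; just)
open import Data.List using (List; foldr; map; filter; length)
open import Data.Bool.ListAction using (any)
open import Data.List using () renaming (allFin to allFinL)
open import Data.Fin.Permutation using (Permutation′; _⟨$⟩ʳ_)
open import Data.Product using (Σ; _×_)
open import Relation.Binary.PropositionalEquality using (_≡_)
open import Relation.Nullary using (¬_)
open import Relation.Nullary.Decidable using (⌊_⌋)

Adj : ℕ → Set
Adj n = Fin n → Fin n → Bool

reach : {n : ℕ} → Adj n → ℕ → Fin n → Fin n → Bool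
reach G zero    u v = ⌊ u ≟F v ⌋
reach G (suc m) u v = reach G m u v ∨ any (λ w → G u w ∧ reach G m w v) (allFinL _)

private
  search : {n : ℕ} → Adj n → Fin n → Fin n → ℕ → ℕ → ℕ
  search G u v m zero       = m
  search G u v m (suc fuel) = if reach G m u v then m else search G u v (suc m) fuel

-- Graph distance d(u,v): the least m with a walk of length m from u to v.
-- (For a connected graph on n vertices this is found within fuel n.)
dist : {n : ℕ} → Adj n → Fin n → Fin n → ℕ
dist {n} G u v = search G u v 0 n

ecc : {n : ℕ} → Adj n → Fin n → ℕ
ecc G v = foldr _⊔_ 0 (map (λ u → dist G u v) (allFinL _))

eccMatrix : {n : ℕ} → Adj n → Fin n → Fin n → ℕ
eccMatrix G u v =
  if dist G u v ≡ᵇ (ecc G u ⊓ ecc G v) then dist G u v else 0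

-- Irreducible: not permutation-similar to a block upper triangular matrix
-- [[A , B] , [0 , C]] with nontrivial square diagonal blocks A (r×r), C.
-- (P M Pᵀ has (i,j) entry M (σ i) (σ j).)
Irreducible : {n : ℕ} → (Fin n → Fin n → ℕ) → Set
Irreducible {n} M =
  ¬ (Σ (Permutation′ n) λ σ → Σ ℕ λ r →
       (0 < r) × (r < n) ×
       ((i j : Fin n) → r ≤ toℕ i → toℕ j < r → M (σ ⟨$⟩ʳ i) (σ ⟨$⟩ʳ j) ≡ 0))

-- k-coalescence of complete graphs.
-- A labelling part : Fin n → Maybe (Fin l) says which block a vertex is in:
-- nothing = the common core C, just i = the private part P_i.

sameBlock : {l : ℕ} → Maybe (Fin l) → Maybe (Fin l) → Bool
sameBlock nothing  _        = true
sameBlock (just _) nothing  = true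
sameBlock (just i) (just j) = ⌊ i ≟F j ⌋

coalAdj : {n l : ℕ} → (Fin n → Maybe (Fin l)) → Adj n
coalAdj part u v = not ⌊ u ≟F v ⌋ ∧ sameBlock (part u) (part v)

isCore : {l : ℕ} → Maybe (Fin l) → Bool
isCore nothing  = true
isCore (just _) = false

inBlock : {l : ℕ} → Fin l → Maybe (Fin l) → Bool
inBlock i nothing  = false
inBlock i (just j) = ⌊ i ≟F j ⌋

countV : {n : ℕ} → (Fin n → Bool) → ℕ
countV p = length (filter (λ x → p x Data.Bool.≟ true) (allFinL _))

-- A core vertex c is adjacent to every other vertex, so e(c) = 1 while every
-- other vertex has eccentricity at least 1; hence ε(c, x) = ε(x, c) = 1 for all
-- x ≠ c. A matrix whose row and column c have no zero off the diagonal is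
-- irreducible: whichever side of the block split c lands on, the zero block
-- would contain one of these entries.
module Submission where

open import Defs
open import Data.Bool using (Bool; true; false; T; _∧_) renaming (_≟_ to _≟B_)
open import Data.Bool.Properties using (T-≡)
open import Data.Bool.ListAction using (any)
open import Data.Empty using (⊥)
open import Data.Fin using (Fin; toℕ; fromℕ<) renaming (zero to fzero)
open import Data.Fin.Properties using (toℕ-fromℕ<) renaming (_≟_ to _≟F_)
open import Data.Fin.Permutation using (_⟨$⟩ʳ_; _⟨$⟩ˡ_; inverseˡ; inverseʳ)
open import Data.List using ([]; _∷_; map; filter; allFin)
open import Data.List.Properties using (foldr-preservesᵇ; foldr-preservesᵒ)
import Data.List.Relation.Unary.All as All
import Data.List.Relation.Unary.All.Properties as All
open import Data.List.Relation.Unary.Any as Any using (here)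
open import Data.List.Relation.Unary.Any.Properties using (any⁺)
open import Data.List.Membership.Propositional using (_∈_)
open import Data.List.Membership.Propositional.Properties using (∈-allFin; ∈-map⁺; ∈-filter⁻)
open import Data.Maybe using (Maybe; nothing; just)
open import Data.Nat using (ℕ; zero; suc; _≤_; _<_; _∸_; _⊓_; _⊔_; _≡ᵇ_; z≤n; _<?_)
open import Data.Nat.Properties
  using (≤-reflexive; ≤-antisym; <-trans; <-≤-trans; <-irrefl; ≮⇒≥; 1+n≢0; ⊔-lub;
         m≤n⇒m≤n⊔o; m≤n⇒m≤o⊔n; m≤n⇒m⊓n≡m; m≥n⇒m⊓n≡n; ≡⇒≡ᵇ)
open import Data.Product using (Σ; _×_; _,_; proj₁; proj₂)
open import Data.Sum using (inj₂; [_,_])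
open import Function using (_∘_; case_of_; Equivalence)
open import Relation.Binary.PropositionalEquality
  using (_≡_; _≢_; refl; sym; trans; cong; cong₂; subst)
open import Relation.Nullary using (¬_; yes; no; contradiction)
open import Relation.Nullary.Decidable using (Dec; ⌊_⌋; isYes≗does; dec-true; dec-false)

⌊⌋-yes : {A : Set} (a? : Dec A) → A → ⌊ a? ⌋ ≡ true
⌊⌋-yes a? a = trans (isYes≗does a?) (dec-true a? a)

⌊⌋-no : {A : Set} (a? : Dec A) → ¬ A → ⌊ a? ⌋ ≡ false
⌊⌋-no a? ¬a = trans (isYes≗does a?) (dec-false a? ¬a)

dist-refl : {n : ℕ} (G : Adj n) (u : Fin n) → dist G u u ≡ 0
dist-refl {suc _} G u rewrite ⌊⌋-yes (u ≟F u) refl = refl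

reach-suc-adjacent : {n : ℕ} (G : Adj n) {u v : Fin n} → G u v ≡ true →
                     any (λ w → G u w ∧ reach G 0 w v) (allFin n) ≡ true
reach-suc-adjacent {n} G {u} {v} Guv =
  Equivalence.to T-≡ (any⁺ _ (Any.map stepToV (∈-allFin v)))
  where
  stepToV : ∀ {w} → v ≡ w → T (G u w ∧ reach G 0 w v)
  stepToV refl = subst T (sym (cong₂ _∧_ Guv (⌊⌋-yes (v ≟F v) refl))) _

dist-adjacent : {n : ℕ} (G : Adj n) {u v : Fin n} → u ≢ v → G u v ≡ true → dist G u v ≡ 1
dist-adjacent {suc zero} G {fzero} {fzero} u≢v _ = contradiction refl u≢v
dist-adjacent {suc (suc _)} G {u} {v} u≢v Guv
  rewrite ⌊⌋-no (u ≟F v) u≢v | reach-suc-adjacent G Guv = refl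

dist≤ecc : {n : ℕ} (G : Adj n) (u v : Fin n) → dist G u v ≤ ecc G v
dist≤ecc {n} G u v =
  foldr-preservesᵒ (λ x y → [ m≤n⇒m≤n⊔o y , m≤n⇒m≤o⊔n x ]) 0 (map (λ w → dist G w v) (allFin n))
    (inj₂ (Any.map ≤-reflexive (∈-map⁺ (λ w → dist G w v) (∈-allFin u))))

ecc≤ : {n : ℕ} (G : Adj n) (v : Fin n) {b : ℕ} → (∀ u → dist G u v ≤ b) → ecc G v ≤ b
ecc≤ {n} G v {b} bound =
  foldr-preservesᵇ {P = _≤ b} {f = _⊔_} ⊔-lub {xs = map (λ u → dist G u v) (allFin n)} z≤n
    (All.map⁺ (All.tabulate (λ {u} _ → bound u)))

eccMatrix-attained : {n : ℕ} (G : Adj n) (u v : Fin n) →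
                     dist G u v ≡ ecc G u ⊓ ecc G v → eccMatrix G u v ≡ dist G u v
eccMatrix-attained G u v attained
  with dist G u v ≡ᵇ (ecc G u ⊓ ecc G v) | ≡⇒≡ᵇ _ _ attained
... | true | _ = refl

Dominating : {n : ℕ} → Adj n → Fin n → Set
Dominating G c = ∀ x → x ≢ c → G x c ≡ true × G c x ≡ true

module _ {n : ℕ} {G : Adj n} {c : Fin n} (dominating : Dominating G c) where

  dist-to-dominating≤1 : ∀ u → dist G u c ≤ 1
  dist-to-dominating≤1 u with u ≟F c
  ... | yes refl rewrite dist-refl G c = z≤n
  ... | no u≢c = ≤-reflexive (dist-adjacent G u≢c (proj₁ (dominating u u≢c)))

  module _ (x : Fin n) (x≢c : x ≢ c) where

    dist-from-dominating : dist G c x ≡ 1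
    dist-from-dominating = dist-adjacent G (x≢c ∘ sym) (proj₂ (dominating x x≢c))

    dist-to-dominating : dist G x c ≡ 1
    dist-to-dominating = dist-adjacent G x≢c (proj₁ (dominating x x≢c))

    ecc-dominating : ecc G c ≡ 1
    ecc-dominating = ≤-antisym (ecc≤ G c dist-to-dominating≤1)
                               (subst (_≤ ecc G c) dist-to-dominating (dist≤ecc G x c))

    1≤ecc : 1 ≤ ecc G x
    1≤ecc = subst (_≤ ecc G x) dist-from-dominating (dist≤ecc G c x)

    eccMatrix-from-dominating : eccMatrix G c x ≡ 1
    eccMatrix-from-dominating = trans (eccMatrix-attained G c x attained) dist-from-dominating
      where
      attained : dist G c x ≡ ecc G c ⊓ ecc G x
      attained rewrite dist-from-dominating | ecc-dominating = sym (m≤n⇒m⊓n≡m 1≤ecc)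

    eccMatrix-to-dominating : eccMatrix G x c ≡ 1
    eccMatrix-to-dominating = trans (eccMatrix-attained G x c attained) dist-to-dominating
      where
      attained : dist G x c ≡ ecc G x ⊓ ecc G c
      attained rewrite dist-to-dominating | ecc-dominating = sym (m≥n⇒m⊓n≡n 1≤ecc)

Hub : {n : ℕ} → (Fin n → Fin n → ℕ) → Fin n → Set
Hub M c = ∀ x → x ≢ c → M c x ≢ 0 × M x c ≢ 0

eccMatrix-hub : {n : ℕ} {G : Adj n} {c : Fin n} → Dominating G c → Hub (eccMatrix G) c
eccMatrix-hub dominating x x≢c =
    1+n≢0 ∘ trans (sym (eccMatrix-from-dominating dominating x x≢c))
  , 1+n≢0 ∘ trans (sym (eccMatrix-to-dominating dominating x x≢c))

hub⇒irreducible : {n : ℕ} (M : Fin n → Fin n → ℕ) (c : Fin n) → Hub M c → Irreducible M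
hub⇒irreducible M c hub (σ , r , 0<r , r<n , zeroBlock) =
  case toℕ ĉ <? r of λ where
    (yes ĉ<r) → c-in-upper-block ĉ<r
    (no ĉ≮r)  → c-in-lower-block (≮⇒≥ ĉ≮r)
  where
  -- Positions < r index the upper diagonal block; zeroBlock has rows ≥ r and columns < r.
  ĉ = σ ⟨$⟩ˡ c

  σĉ≡c : σ ⟨$⟩ʳ ĉ ≡ c
  σĉ≡c = inverseʳ σ

  σ-off-c : ∀ {i} → toℕ i ≢ toℕ ĉ → σ ⟨$⟩ʳ i ≢ c
  σ-off-c i≢ĉ σi≡c = i≢ĉ (cong toℕ (trans (sym (inverseˡ σ)) (cong (σ ⟨$⟩ˡ_) σi≡c)))

  lower upper : Fin _
  lower = fromℕ< r<n
  upper = fromℕ< (<-trans 0<r r<n)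

  toℕ-lower : toℕ lower ≡ r
  toℕ-lower = toℕ-fromℕ< r<n

  toℕ-upper : toℕ upper ≡ 0
  toℕ-upper = toℕ-fromℕ< (<-trans 0<r r<n)

  c-in-upper-block : toℕ ĉ < r → ⊥
  c-in-upper-block ĉ<r = proj₂ (hub (σ ⟨$⟩ʳ lower) (σ-off-c lower≢ĉ)) zeroEntry
    where
    lower≢ĉ : toℕ lower ≢ toℕ ĉ
    lower≢ĉ lower≡ĉ = <-irrefl (trans (sym lower≡ĉ) toℕ-lower) ĉ<r
    zeroEntry : M (σ ⟨$⟩ʳ lower) c ≡ 0
    zeroEntry = subst (λ y → M (σ ⟨$⟩ʳ lower) y ≡ 0) σĉ≡c
                  (zeroBlock lower ĉ (≤-reflexive (sym toℕ-lower)) ĉ<r)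

  c-in-lower-block : r ≤ toℕ ĉ → ⊥
  c-in-lower-block r≤ĉ = proj₁ (hub (σ ⟨$⟩ʳ upper) (σ-off-c upper≢ĉ)) zeroEntry
    where
    upper<r : toℕ upper < r
    upper<r = subst (_< r) (sym toℕ-upper) 0<r
    upper≢ĉ : toℕ upper ≢ toℕ ĉ
    upper≢ĉ upper≡ĉ = <-irrefl refl (<-≤-trans upper<r (subst (r ≤_) (sym upper≡ĉ) r≤ĉ))
    zeroEntry : M c (σ ⟨$⟩ʳ upper) ≡ 0
    zeroEntry = subst (λ y → M y (σ ⟨$⟩ʳ upper) ≡ 0) σĉ≡c (zeroBlock ĉ upper r≤ĉ upper<r)

countV-witness : {n : ℕ} (p : Fin n → Bool) → 1 ≤ countV p → Σ (Fin n) λ x → p x ≡ true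
countV-witness {n} p 1≤count with filter (λ y → p y ≟B true) (allFin n) in eq
... | [] with () ← 1≤count
... | x ∷ _ =
  x , proj₂ (∈-filter⁻ (λ y → p y ≟B true) {xs = allFin n} (subst (x ∈_) (sym eq) (here refl)))

isCore⇒nothing : {l : ℕ} (m : Maybe (Fin l)) → isCore m ≡ true → m ≡ nothing
isCore⇒nothing nothing _ = refl

sameBlock-nothingʳ : {l : ℕ} (m : Maybe (Fin l)) → sameBlock m nothing ≡ true
sameBlock-nothingʳ nothing  = refl
sameBlock-nothingʳ (just _) = refl

core-dominating : {n l : ℕ} (part : Fin n → Maybe (Fin l)) {c : Fin n} →
                  part c ≡ nothing → Dominating (coalAdj part) c
core-dominating part {c} c-core x x≢c
  rewrite ⌊⌋-no (x ≟F c) x≢c | ⌊⌋-no (c ≟F x) (x≢c ∘ sym) | c-core =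
  sameBlock-nothingʳ (part x) , refl

mainTheorem12 : (l : ℕ) → 2 ≤ l → (a : Fin l → ℕ) → (∀ i → 3 ≤ a i) →
                (k : ℕ) → 1 ≤ k → (∀ i → k < a i) →
                (n : ℕ) → (part : Fin n → Maybe (Fin l)) →
                countV (λ x → isCore (part x)) ≡ k →
                (∀ i → countV (λ x → inBlock i (part x)) ≡ a i ∸ k) →
                Irreducible (eccMatrix (coalAdj part))
mainTheorem12 _ _ _ _ k 1≤k _ _ part #core≡k _ =
  hub⇒irreducible (eccMatrix (coalAdj part)) c
    (eccMatrix-hub (core-dominating part (isCore⇒nothing (part c) c-core)))
  where
  core-vertex : Σ _ λ x → isCore (part x) ≡ true
  core-vertex = countV-witness (λ x → isCore (part x)) (subst (1 ≤_) (sym #core≡k) 1≤k)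
  c = proj₁ core-vertex
  c-core = proj₂ core-vertex
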